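{- Let $q\ge 3$ be a prime power, let $n,d$ be integers with $n-d\ge 2$, and let $v=n+1-d$. Set $$T=\Big(2+\frac{q^2-2q}{q^{n-d}}\Big)v+1+\frac{q^2-2q}{q^{n-d}}-\Big(\frac1q+\frac1{q^2}+\cdots+\frac1{q^{n-d-1}}\Big).$$ (1) If $q>T$, then $\dfrac{q^{n+1-d}-1}{q-1}\cdot\dfrac{q}{n+2-d} > 2q^{n-d}+(q-2)q$. (2) If $q<T$, then $\dfrac{q^{n+1-d}-1}{q-1}\cdot\dfrac{q}{n+2-d} < 2q^{n-d}+(q-2)q$. -}

module Defs where

open import Data.Nat as ℕ using (ℕ; zero; suc; _≤_; _∸_; NonZero; >-nonZero)
open import Data.Nat.Properties as ℕP using (m^n≢0; ≤-trans)
open import Data.Nat.Primality using (Prime)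
open import Data.Integer as ℤ using (ℤ; +_; ∣_∣)
open import Data.Rational as ℚ using (ℚ; _/_; _+_; _*_; _-_)
open import Data.Product using (Σ; _×_)
open import Relation.Binary.PropositionalEquality using (_≡_)

IsPrimePower : ℕ → Set
IsPrimePower q = Σ ℕ λ p → Σ ℕ λ e → Prime p × (1 ≤ e) × (q ≡ p ℕ.^ e)

nz-q : ∀ {q} → 3 ≤ q → NonZero q
nz-q h = >-nonZero (≤-trans (ℕ.s≤s ℕ.z≤n) h)

nz-q-1 : ∀ {q} → 3 ≤ q → NonZero (q ∸ 1)
nz-q-1 (ℕ.s≤s (ℕ.s≤s h)) = >-nonZero (ℕ.s≤s ℕ.z≤n)

invPow : (q : ℕ) → 3 ≤ q → ℕ → ℚ
invPow q h i = (+ 1) / (q ℕ.^ i) where instance _ = m^n≢0 q i {{nz-q h}}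

invSum : (q : ℕ) → 3 ≤ q → ℕ → ℚ
invSum q h zero = ℚ.0ℚ
invSum q h (suc m) = invSum q h m + invPow q h (suc m)

cTerm : (q : ℕ) → 3 ≤ q → ℕ → ℚ
cTerm q h k = (+ q ℤ.* + q ℤ.- + 2 ℤ.* + q) / (q ℕ.^ k)
  where instance _ = m^n≢0 q k {{nz-q h}}

T : (q : ℕ) → 3 ≤ q → ℤ → ℤ → ℚ
T q h n d =
  (ℚ.1ℚ + ℚ.1ℚ + cTerm q h k) * v + ℚ.1ℚ + cTerm q h k - invSum q h (k ∸ 1)
  where
  k : ℕ
  k = ∣ n ℤ.- d ∣
  v : ℚ
  v = (n ℤ.+ + 1 ℤ.- d) / 1

LHS : (q : ℕ) → 3 ≤ q → ℤ → ℤ → ℚ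
LHS q h n d =
  ((+ (q ℕ.^ suc k) ℤ.- + 1) / (q ∸ 1)) * ((+ q) / suc (suc k))
  where
  k : ℕ
  k = ∣ n ℤ.- d ∣
  instance _ = nz-q-1 h

RHS : ℕ → ℤ → ℤ → ℚ
RHS q n d = (+ 2 ℤ.* + (q ℕ.^ ∣ n ℤ.- d ∣) ℤ.+ (+ q ℤ.- + 2) ℤ.* + q) / 1

-- Write k = n − d, P = q^k and v = k + 1, so that the left-hand side is A·B with
-- A = (qP − 1)/(q − 1) and B = q/(v + 1). The geometric sum gives
-- (q − 1)(1/q + ⋯ + 1/q^(k−1))·P = P − q, and clearing denominators turns the
-- comparison into the polynomial identity
--   (A·B − (2P + (q − 2)q)) · (q − 1)(v + 1) = (q − T) · (q − 1)P.
-- Both cofactors are positive, so the difference of the two sides has the sign of q − T.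
module Submission where

open import Defs
open import Data.Nat as ℕ using (ℕ; zero; suc; _≤_; _∸_; _^_; z≤n; s≤s; NonZero)
import Data.Nat.Properties as ℕP
open import Data.Integer as ℤ using (ℤ; +_; _-_; ∣_∣) renaming (_≤_ to _≤ℤ_)
import Data.Integer.Properties as ℤP
open import Data.Integer.Tactic.RingSolver as ℤSolver using ()
open import Data.Rational as ℚ using (ℚ; _/_; _+_; _*_; -_; 0ℚ; 1ℚ; _<_; Positive; toℚᵘ; fromℚᵘ)
open import Data.Rational.Properties
open import Data.Rational.Unnormalised as ℚᵘ using (mkℚᵘ; *≡*)
import Data.Rational.Unnormalised.Properties as ℚᵘP
open import Data.List using (_∷_; [])
open import Data.Product using (_×_; _,_)
open import Level using (0ℓ)
open import Relation.Binary.PropositionalEquality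
open import Relation.Nullary.Decidable using (dec⇒maybe)
open import Tactic.RingSolver using (solve; solve-∀)
open import Tactic.RingSolver.Core.AlmostCommutativeRing using (AlmostCommutativeRing; fromCommutativeRing)

-- The solver can only cancel coefficients that this zero test recognises.
ℚ-ring : AlmostCommutativeRing 0ℓ 0ℓ
ℚ-ring = fromCommutativeRing +-*-commutativeRing (λ x → dec⇒maybe (0ℚ ≟ x))

fromℚᵘ-homo-+ : ∀ p q → fromℚᵘ (p ℚᵘ.+ q) ≡ fromℚᵘ p + fromℚᵘ q
fromℚᵘ-homo-+ p q = toℚᵘ-injective (begin
  toℚᵘ (fromℚᵘ (p ℚᵘ.+ q))              ≈⟨ toℚᵘ-fromℚᵘ (p ℚᵘ.+ q) ⟩
  p ℚᵘ.+ q                              ≈⟨ ℚᵘP.+-cong (toℚᵘ-fromℚᵘ p) (toℚᵘ-fromℚᵘ q) ⟨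
  toℚᵘ (fromℚᵘ p) ℚᵘ.+ toℚᵘ (fromℚᵘ q)  ≈⟨ toℚᵘ-homo-+ (fromℚᵘ p) (fromℚᵘ q) ⟨
  toℚᵘ (fromℚᵘ p + fromℚᵘ q)            ∎)
  where open ℚᵘP.≃-Reasoning

fromℚᵘ-homo-* : ∀ p q → fromℚᵘ (p ℚᵘ.* q) ≡ fromℚᵘ p * fromℚᵘ q
fromℚᵘ-homo-* p q = toℚᵘ-injective (begin
  toℚᵘ (fromℚᵘ (p ℚᵘ.* q))              ≈⟨ toℚᵘ-fromℚᵘ (p ℚᵘ.* q) ⟩
  p ℚᵘ.* q                              ≈⟨ ℚᵘP.*-cong (toℚᵘ-fromℚᵘ p) (toℚᵘ-fromℚᵘ q) ⟨
  toℚᵘ (fromℚᵘ p) ℚᵘ.* toℚᵘ (fromℚᵘ q)  ≈⟨ toℚᵘ-homo-* (fromℚᵘ p) (fromℚᵘ q) ⟨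
  toℚᵘ (fromℚᵘ p * fromℚᵘ q)            ∎)
  where open ℚᵘP.≃-Reasoning

fromℚᵘ-homo‿- : ∀ p → fromℚᵘ (ℚᵘ.- p) ≡ ℚ.- fromℚᵘ p
fromℚᵘ-homo‿- p = toℚᵘ-injective (begin
  toℚᵘ (fromℚᵘ (ℚᵘ.- p))  ≈⟨ toℚᵘ-fromℚᵘ (ℚᵘ.- p) ⟩
  ℚᵘ.- p                  ≈⟨ ℚᵘP.-‿cong (toℚᵘ-fromℚᵘ p) ⟨
  ℚᵘ.- toℚᵘ (fromℚᵘ p)    ≈⟨ toℚᵘ-homo‿- (fromℚᵘ p) ⟨
  toℚᵘ (- fromℚᵘ p)       ∎)
  where open ℚᵘP.≃-Reasoning

fromℤ : ℤ → ℚ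
fromℤ i = i / 1

fromℤ-homo-+ : ∀ i j → fromℤ (i ℤ.+ j) ≡ fromℤ i + fromℤ j
fromℤ-homo-+ i j = trans
  (fromℚᵘ-cong {mkℚᵘ (i ℤ.+ j) 0} {mkℚᵘ i 0 ℚᵘ.+ mkℚᵘ j 0} (*≡* cross-multiplied))
  (fromℚᵘ-homo-+ (mkℚᵘ i 0) (mkℚᵘ j 0))
  where
  cross-multiplied : (i ℤ.+ j) ℤ.* + 1 ≡ (i ℤ.* + 1 ℤ.+ j ℤ.* + 1) ℤ.* + 1
  cross-multiplied = ℤSolver.solve (i ∷ j ∷ [])

fromℤ-homo-* : ∀ i j → fromℤ (i ℤ.* j) ≡ fromℤ i * fromℤ j
fromℤ-homo-* i j = fromℚᵘ-homo-* (mkℚᵘ i 0) (mkℚᵘ j 0)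

fromℤ-homo-minus : ∀ i j → fromℤ (i - j) ≡ fromℤ i ℚ.- fromℤ j
fromℤ-homo-minus i j =
  trans (fromℤ-homo-+ i (ℤ.- j)) (cong (_+_ (fromℤ i)) (fromℚᵘ-homo‿- (mkℚᵘ j 0)))

fromℤ-pow-suc : ∀ q j → fromℤ (+ (q ^ suc j)) ≡ fromℤ (+ q) * fromℤ (+ (q ^ j))
fromℤ-pow-suc q j = trans (cong fromℤ (ℤP.pos-* q (q ^ j))) (fromℤ-homo-* (+ q) (+ (q ^ j)))

fromℤ-pos : ∀ m .{{_ : NonZero m}} → Positive (fromℤ (+ m))
fromℤ-pos m = normalize-pos m 1

/-*-cancel : ∀ i m .{{_ : NonZero m}} → (i / m) * fromℤ (+ m) ≡ fromℤ i
/-*-cancel i (suc m) = trans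
  (sym (fromℚᵘ-homo-* (mkℚᵘ i m) (mkℚᵘ (+ suc m) 0)))
  (fromℚᵘ-cong {mkℚᵘ i m ℚᵘ.* mkℚᵘ (+ suc m) 0} {mkℚᵘ i 0} (*≡* cross-multiplied))
  where
  cross-multiplied : i ℤ.* + suc m ℤ.* + 1 ≡ i ℤ.* + (suc m ℕ.* 1)
  cross-multiplied = trans (ℤP.*-identityʳ _) (cong (λ z → i ℤ.* + z) (sym (ℕP.*-identityʳ (suc m))))

2ℚ : ℚ
2ℚ = fromℤ (+ 2)

invSum-geometric : ∀ q (hq : 3 ≤ q) k → 1 ≤ k →
  (fromℤ (+ q) ℚ.- 1ℚ) * (invSum q hq (k ∸ 1) * fromℤ (+ (q ^ k))) ≡ fromℤ (+ (q ^ k)) ℚ.- fromℤ (+ q)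
invSum-geometric q hq (suc zero) _ = begin
  (Q ℚ.- 1ℚ) * (0ℚ * fromℤ (+ (q ^ 1)))   ≡⟨ cong (_*_ (Q ℚ.- 1ℚ)) (*-zeroˡ (fromℤ (+ (q ^ 1)))) ⟩
  (Q ℚ.- 1ℚ) * 0ℚ                         ≡⟨ *-zeroʳ (Q ℚ.- 1ℚ) ⟩
  0ℚ                                      ≡⟨ +-inverseʳ Q ⟨
  Q ℚ.- Q                                 ≡⟨ cong (λ x → fromℤ (+ x) ℚ.- Q) (ℕP.*-identityʳ q) ⟨
  fromℤ (+ (q ^ 1)) ℚ.- Q                 ∎
  where open ≡-Reasoning
        Q = fromℤ (+ q)
invSum-geometric q hq (suc (suc m)) _ = begin
  (Q ℚ.- 1ℚ) * ((s + q⁻ᵐ) * fromℤ (+ (q ^ suc (suc m))))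
    ≡⟨ cong (λ x → (Q ℚ.- 1ℚ) * ((s + q⁻ᵐ) * x)) (fromℤ-pow-suc q (suc m)) ⟩
  (Q ℚ.- 1ℚ) * ((s + q⁻ᵐ) * (Q * P))
    ≡⟨ distribute Q P s q⁻ᵐ ⟩
  Q * ((Q ℚ.- 1ℚ) * (s * P)) + (Q ℚ.- 1ℚ) * Q * (q⁻ᵐ * P)
    ≡⟨ cong₂ (λ x y → Q * x + (Q ℚ.- 1ℚ) * Q * y)
             (invSum-geometric q hq (suc m) (s≤s z≤n))
             (/-*-cancel (+ 1) (q ^ suc m) {{ℕP.m^n≢0 q (suc m) {{nz-q hq}}}}) ⟩
  Q * (P ℚ.- Q) + (Q ℚ.- 1ℚ) * Q * 1ℚ
    ≡⟨ collect Q P ⟩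
  Q * P ℚ.- Q
    ≡⟨ cong (λ x → x ℚ.- Q) (fromℤ-pow-suc q (suc m)) ⟨
  fromℤ (+ (q ^ suc (suc m))) ℚ.- Q ∎
  where
  open ≡-Reasoning
  Q P s q⁻ᵐ : ℚ
  Q = fromℤ (+ q)
  P = fromℤ (+ (q ^ suc m))
  s = invSum q hq m
  q⁻ᵐ = invPow q hq (suc m)
  distribute : ∀ Q P s t →
    (Q ℚ.- 1ℚ) * ((s + t) * (Q * P)) ≡ Q * ((Q ℚ.- 1ℚ) * (s * P)) + (Q ℚ.- 1ℚ) * Q * (t * P)
  distribute = solve-∀ ℚ-ring
  collect : ∀ Q P → Q * (P ℚ.- Q) + (Q ℚ.- 1ℚ) * Q * 1ℚ ≡ Q * P ℚ.- Q
  collect = solve-∀ ℚ-ring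

p<q⇒0<q-p : ∀ {p q} → p < q → 0ℚ < q ℚ.- p
p<q⇒0<q-p {p} {q} p<q = subst (_< q ℚ.- p) (+-inverseʳ p) (+-monoˡ-< (- p) p<q)

p<q⇒p-q<0 : ∀ {p q} → p < q → p ℚ.- q < 0ℚ
p<q⇒p-q<0 {p} {q} p<q = subst (p ℚ.- q <_) (+-inverseʳ q) (+-monoˡ-< (- q) p<q)

p-q+q≡p : ∀ p q → p ℚ.- q + q ≡ p
p-q+q≡p = solve-∀ ℚ-ring

0<p-q⇒q<p : ∀ {p q} → 0ℚ < p ℚ.- q → q < p
0<p-q⇒q<p {p} {q} 0<p-q = subst₂ _<_ (+-identityˡ q) (p-q+q≡p p q) (+-monoˡ-< q 0<p-q)

p-q<0⇒p<q : ∀ {p q} → p ℚ.- q < 0ℚ → p < q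
p-q<0⇒p<q {p} {q} p-q<0 = subst₂ _<_ (p-q+q≡p p q) (+-identityˡ q) (+-monoˡ-< q p-q<0)

sign-comparison : ∀ {L R x t} b p .{{_ : Positive b}} .{{_ : Positive p}} →
  (L ℚ.- R) * b ≡ (x ℚ.- t) * p → (t < x → R < L) × (x < t → L < R)
sign-comparison {L} {R} {x} {t} b p eq =
    (λ t<x → 0<p-q⇒q<p (*-cancelʳ-<-nonNeg b {{pos⇒nonNeg b}}
                         (subst₂ _<_ 0*p≡0*b (sym eq) (*-monoˡ-<-pos p (p<q⇒0<q-p t<x)))))
  , (λ x<t → p-q<0⇒p<q (*-cancelʳ-<-nonNeg b {{pos⇒nonNeg b}}
                         (subst₂ _<_ (sym eq) 0*p≡0*b (*-monoˡ-<-pos p (p<q⇒p-q<0 x<t)))))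
  where
  0*p≡0*b : 0ℚ * p ≡ 0ℚ * b
  0*p≡0*b = trans (*-zeroˡ p) (sym (*-zeroˡ b))

cleared-difference : ∀ Q P c s V A B →
  A * (Q ℚ.- 1ℚ) ≡ Q * P ℚ.- 1ℚ →
  B * (V + 1ℚ) ≡ Q →
  c * P ≡ Q * Q ℚ.- 2ℚ * Q →
  (Q ℚ.- 1ℚ) * (s * P) ≡ P ℚ.- Q →
  (A * B ℚ.- (2ℚ * P + (Q ℚ.- 2ℚ) * Q)) * ((Q ℚ.- 1ℚ) * (V + 1ℚ))
    ≡ (Q ℚ.- ((1ℚ + 1ℚ + c) * V + 1ℚ + c ℚ.- s)) * ((Q ℚ.- 1ℚ) * P)
cleared-difference Q P c s V A B A*[Q-1] B*[V+1] c*P [Q-1]*s*P = begin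
  (A * B ℚ.- (2ℚ * P + (Q ℚ.- 2ℚ) * Q)) * ((Q ℚ.- 1ℚ) * (V + 1ℚ))
    ≡⟨ solve (Q ∷ P ∷ V ∷ A ∷ B ∷ []) ℚ-ring ⟩
  (A * (Q ℚ.- 1ℚ)) * (B * (V + 1ℚ)) ℚ.- (Q ℚ.- 1ℚ) * (V + 1ℚ) * (2ℚ * P + (Q ℚ.- 2ℚ) * Q)
    ≡⟨ cong₂ (λ x y → x * y ℚ.- (Q ℚ.- 1ℚ) * (V + 1ℚ) * (2ℚ * P + (Q ℚ.- 2ℚ) * Q)) A*[Q-1] B*[V+1] ⟩
  (Q * P ℚ.- 1ℚ) * Q ℚ.- (Q ℚ.- 1ℚ) * (V + 1ℚ) * (2ℚ * P + (Q ℚ.- 2ℚ) * Q)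
    ≡⟨ solve (Q ∷ P ∷ V ∷ []) ℚ-ring ⟩
  (Q ℚ.- 1ℚ) * ((Q ℚ.- 2ℚ * V ℚ.- 1ℚ) * P ℚ.- (Q * Q ℚ.- 2ℚ * Q) * (V + 1ℚ)) + (P ℚ.- Q)
    ≡⟨ cong₂ (λ x y → (Q ℚ.- 1ℚ) * ((Q ℚ.- 2ℚ * V ℚ.- 1ℚ) * P ℚ.- x * (V + 1ℚ)) + y) (sym c*P) (sym [Q-1]*s*P) ⟩
  (Q ℚ.- 1ℚ) * ((Q ℚ.- 2ℚ * V ℚ.- 1ℚ) * P ℚ.- c * P * (V + 1ℚ)) + (Q ℚ.- 1ℚ) * (s * P)
    ≡⟨ solve (Q ∷ P ∷ c ∷ s ∷ V ∷ []) ℚ-ring ⟩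
  (Q ℚ.- ((1ℚ + 1ℚ + c) * V + 1ℚ + c ℚ.- s)) * ((Q ℚ.- 1ℚ) * P) ∎
  where open ≡-Reasoning

module Comparison (q : ℕ) (hq : 3 ≤ q) (n d : ℤ) (1≤n-d : + 1 ≤ℤ n - d) where
  open ≡-Reasoning

  k : ℕ
  k = ∣ n - d ∣

  +k≡n-d : + k ≡ n - d
  +k≡n-d = ℤP.0≤i⇒+∣i∣≡i (ℤP.≤-trans (ℤ.+≤+ z≤n) 1≤n-d)

  1≤k : 1 ≤ k
  1≤k = ℤP.drop‿+≤+ (subst (+ 1 ≤ℤ_) (sym +k≡n-d) 1≤n-d)

  Q P V A B : ℚ
  Q = fromℤ (+ q)
  P = fromℤ (+ (q ^ k))
  V = fromℤ (n ℤ.+ + 1 - d)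
  A = ((+ (q ^ suc k) - + 1) / (q ∸ 1)) {{nz-q-1 hq}}
  B = + q / suc (suc k)

  Q-1≡q∸1 : Q ℚ.- 1ℚ ≡ fromℤ (+ (q ∸ 1))
  Q-1≡q∸1 = trans (sym (fromℤ-homo-minus (+ q) (+ 1))) (cong fromℤ (ℤP.⊖-≥ (ℕP.≤-trans (s≤s z≤n) hq)))

  V+1≡k+2 : V + 1ℚ ≡ fromℤ (+ suc (suc k))
  V+1≡k+2 = trans (sym (fromℤ-homo-+ (n ℤ.+ + 1 - d) (+ 1))) (cong fromℤ (begin
    n ℤ.+ + 1 - d ℤ.+ + 1   ≡⟨ ℤSolver.solve (n ∷ d ∷ []) ⟩
    (n - d) ℤ.+ + 2         ≡⟨ cong (ℤ._+ + 2) +k≡n-d ⟨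
    + (k ℕ.+ 2)             ≡⟨ cong +_ (ℕP.+-comm k 2) ⟩
    + suc (suc k)           ∎))

  A*[Q-1] : A * (Q ℚ.- 1ℚ) ≡ Q * P ℚ.- 1ℚ
  A*[Q-1] = begin
    A * (Q ℚ.- 1ℚ)                ≡⟨ cong (A *_) Q-1≡q∸1 ⟩
    A * fromℤ (+ (q ∸ 1))         ≡⟨ /-*-cancel (+ (q ^ suc k) - + 1) (q ∸ 1) {{nz-q-1 hq}} ⟩
    fromℤ (+ (q ^ suc k) - + 1)   ≡⟨ fromℤ-homo-minus (+ (q ^ suc k)) (+ 1) ⟩
    fromℤ (+ (q ^ suc k)) ℚ.- 1ℚ  ≡⟨ cong (ℚ._- 1ℚ) (fromℤ-pow-suc q k) ⟩
    Q * P ℚ.- 1ℚ                  ∎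

  B*[V+1] : B * (V + 1ℚ) ≡ Q
  B*[V+1] = trans (cong (B *_) V+1≡k+2) (/-*-cancel (+ q) (suc (suc k)))

  cTerm*P : cTerm q hq k * P ≡ Q * Q ℚ.- 2ℚ * Q
  cTerm*P = begin
    cTerm q hq k * P
      ≡⟨ /-*-cancel (+ q ℤ.* + q - + 2 ℤ.* + q) (q ^ k) {{ℕP.m^n≢0 q k {{nz-q hq}}}} ⟩
    fromℤ (+ q ℤ.* + q - + 2 ℤ.* + q)
      ≡⟨ fromℤ-homo-minus (+ q ℤ.* + q) (+ 2 ℤ.* + q) ⟩
    fromℤ (+ q ℤ.* + q) ℚ.- fromℤ (+ 2 ℤ.* + q)
      ≡⟨ cong₂ ℚ._-_ (fromℤ-homo-* (+ q) (+ q)) (fromℤ-homo-* (+ 2) (+ q)) ⟩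
    Q * Q ℚ.- 2ℚ * Q ∎

  RHS≡2P+[q-2]q : RHS q n d ≡ 2ℚ * P + (Q ℚ.- 2ℚ) * Q
  RHS≡2P+[q-2]q = begin
    RHS q n d
      ≡⟨ fromℤ-homo-+ (+ 2 ℤ.* + (q ^ k)) ((+ q - + 2) ℤ.* + q) ⟩
    fromℤ (+ 2 ℤ.* + (q ^ k)) + fromℤ ((+ q - + 2) ℤ.* + q)
      ≡⟨ cong₂ _+_ (fromℤ-homo-* (+ 2) (+ (q ^ k)))
                   (trans (fromℤ-homo-* (+ q - + 2) (+ q)) (cong (_* Q) (fromℤ-homo-minus (+ q) (+ 2)))) ⟩
    2ℚ * P + (Q ℚ.- 2ℚ) * Q ∎

  difference-identity :
    (LHS q hq n d ℚ.- RHS q n d) * ((Q ℚ.- 1ℚ) * (V + 1ℚ)) ≡ (Q ℚ.- T q hq n d) * ((Q ℚ.- 1ℚ) * P)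
  difference-identity = trans
    (cong (λ R → (A * B ℚ.- R) * ((Q ℚ.- 1ℚ) * (V + 1ℚ))) RHS≡2P+[q-2]q)
    (cleared-difference Q P (cTerm q hq k) (invSum q hq (k ∸ 1)) V A B
       A*[Q-1] B*[V+1] cTerm*P (invSum-geometric q hq k 1≤k))

  instance
    Q-1-pos : Positive (Q ℚ.- 1ℚ)
    Q-1-pos = subst Positive (sym Q-1≡q∸1) (fromℤ-pos (q ∸ 1) {{nz-q-1 hq}})
    V+1-pos : Positive (V + 1ℚ)
    V+1-pos = subst Positive (sym V+1≡k+2) (fromℤ-pos (suc (suc k)))
    P-pos : Positive P
    P-pos = fromℤ-pos (q ^ k) {{ℕP.m^n≢0 q k {{nz-q hq}}}}
    [Q-1]*[V+1]-pos : Positive ((Q ℚ.- 1ℚ) * (V + 1ℚ))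
    [Q-1]*[V+1]-pos = pos*pos⇒pos (Q ℚ.- 1ℚ) (V + 1ℚ)
    [Q-1]*P-pos : Positive ((Q ℚ.- 1ℚ) * P)
    [Q-1]*P-pos = pos*pos⇒pos (Q ℚ.- 1ℚ) P

proposition5p1 : (q : ℕ) → (hq : 3 ≤ q) → IsPrimePower q → (n d : ℤ) → + 2 ≤ℤ n - d →
    ((T q hq n d < ((+ q) / 1) → RHS q n d < LHS q hq n d)
    × (((+ q) / 1) < T q hq n d → LHS q hq n d < RHS q n d))
proposition5p1 q hq _ n d 2≤n-d =
  sign-comparison ((Q ℚ.- 1ℚ) * (V + 1ℚ)) ((Q ℚ.- 1ℚ) * P) difference-identity
  where open Comparison q hq n d (ℤP.≤-trans (ℤ.+≤+ (s≤s z≤n)) 2≤n-d)
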